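{- For every $\varphi\in\mathcal{L}_{KB}$: $\mathsf{KB}^{ - }_{=}\vdash\varphi$ if and only if $\mathsf{KB}_{=}\vdash\varphi$.
   Context: Fix a set $\mathsf{Prop}$ of propositional letters. Language $\mathcal{L}_{KB}$: $\varphi::=\top\mid p\mid\neg\varphi\mid\varphi\wedge\varphi\mid K\varphi\mid B\varphi$ with Boolean abbreviations, $\check K:=\neg K\neg$, $\check B:=\neg B\neg$. Segerberg notation: $(\varphi_i\mathbb{I}\psi_i)_{i=1}^m$ is the formula $K(F_0\vee\cdots\vee F_m)$, where $F_i$ is the disjunction of all conjunctions $d_1\varphi_1\wedge\cdots\wedge d_m\varphi_m\wedge e_1\psi_1\wedge\cdots\wedge e_m\psi_m$ in which exactly $i$ of the $d_k$ are the empty string, at least $i$ of the $e_k$ are the empty string, and the remaining $d_k,e_k$ are $\neg$. Calculus $\mathsf{KB}$: axiom schemes (CL) classical tautologies; (KS5) the $\mathsf{S5}$ schemes for $K$; (BF) $\neg B\bot$; (N) $B\top$; (Ap) $B\varphi\to KB\varphi$; (An) $\neg B\varphi\to K\neg B\varphi$; (KBM) $K(\varphi\to\psi)\to(B\varphi\to B\psi)$; rules modus ponens and (MN) from $\varphi$ infer $K\varphi$. $\mathsf{KB}_{=}$ is $\mathsf{KB}$ plus the schemes (D) $B\varphi\to\check B\varphi$; (SC) $\check B\varphi\wedge\check K(\neg\varphi\wedge\psi)\to B(\varphi\vee\psi)$; (Scott) $\big[(\varphi_i\mathbb{I}\psi_i)_{i=1}^m\wedge B\varphi_1\wedge\bigwedge_{i=2}^m\check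 B\varphi_i\big]\to\bigvee_{i=1}^m B\psi_i$ for every $m\in\mathbb{Z}^+$. $\mathsf{KB}^{ - }_{=}$ is $\mathsf{KB}_{=}$ with the schemes (BF) and (KBM) omitted. -}

module Defs where

open import Data.Bool using (Bool; true; false; not; _∧_)
open import Data.Nat using (ℕ; zero; suc; _≤_)
open import Data.List using (List; []; _∷_; _++_; map; concatMap; filter)
open import Data.Vec using (Vec; []; _∷_; zipWith; toList; head; tail)
open import Data.Fin using (Fin)
open import Data.Sum using (_⊎_)
open import Data.Product using (_×_; _,_; proj₁; proj₂)
open import Relation.Binary.PropositionalEquality using (_≡_)
open import Relation.Nullary.Decidable using (_×-dec_)
import Data.Nat as ℕ

data Form (Prop : Set) : Set where
  ⊤'  : Form Prop
  var : Prop → Form Prop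
  ¬'_ : Form Prop → Form Prop
  _∧'_ : Form Prop → Form Prop → Form Prop
  K   : Form Prop → Form Prop
  B   : Form Prop → Form Prop

infix  9 ¬'_
infixl 7 _∧'_

module _ {Prop : Set} where

  infixl 6 _∨'_
  infixr 5 _⇒_

  ⊥' : Form Prop
  ⊥' = ¬' ⊤'

  _∨'_ : Form Prop → Form Prop → Form Prop
  φ ∨' ψ = ¬' (¬' φ ∧' ¬' ψ)

  _⇒_ : Form Prop → Form Prop → Form Prop
  φ ⇒ ψ = ¬' (φ ∧' ¬' ψ)

  Kˇ : Form Prop → Form Prop
  Kˇ φ = ¬' K (¬' φ)

  Bˇ : Form Prop → Form Prop
  Bˇ φ = ¬' B (¬' φ)

  ⋀ : List (Form Prop) → Form Prop
  ⋀ []           = ⊤'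
  ⋀ (φ ∷ [])     = φ
  ⋀ (φ ∷ ψ ∷ xs) = φ ∧' ⋀ (ψ ∷ xs)

  ⋁ : List (Form Prop) → Form Prop
  ⋁ []           = ⊥'
  ⋁ (φ ∷ [])     = φ
  ⋁ (φ ∷ ψ ∷ xs) = φ ∨' ⋁ (ψ ∷ xs)

  -- Classical tautologies: formulas true under every Boolean valuation
  -- that treats letters and modal formulas K φ, B φ as atoms.

  evalB : (Form Prop → Bool) → Form Prop → Bool
  evalB v ⊤'        = true
  evalB v (var p)   = v (var p)
  evalB v (¬' φ)    = not (evalB v φ)
  evalB v (φ ∧' ψ)  = evalB v φ ∧ evalB v ψ
  evalB v (K φ)     = v (K φ)
  evalB v (B φ)     = v (B φ)

  Tautology : Form Prop → Set
  Tautology φ = (v : Form Prop → Bool) → evalB v φ ≡ true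

  -- all sign vectors of length m (true = empty string, false = ¬)
  allSigns : (m : ℕ) → List (Vec Bool m)
  allSigns zero    = [] ∷ []
  allSigns (suc m) = concatMap (λ v → (true ∷ v) ∷ (false ∷ v) ∷ []) (allSigns m)

  count : ∀ {m} → Vec Bool m → ℕ
  count []           = 0
  count (true ∷ v)   = suc (count v)
  count (false ∷ v)  = count v

  signed : Bool → Form Prop → Form Prop
  signed true  φ = φ
  signed false φ = ¬' φ

  signedConj : ∀ {m} → Vec (Form Prop) m → Vec (Form Prop) m
             → Vec Bool m → Vec Bool m → Form Prop
  signedConj φs ψs ds es =
    ⋀ (toList (zipWith signed ds φs) ++ toList (zipWith signed es ψs))

  pairsF : (m i : ℕ) → List (Vec Bool m × Vec Bool m)
  pairsF m i = filter (λ de → (count (proj₁ de) ℕ.≟ i) ×-dec (i ℕ.≤? count (proj₂ de)))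
                 (concatMap (λ d → map (d ,_) (allSigns m)) (allSigns m))

  F : ∀ {m} → Vec (Form Prop) m → Vec (Form Prop) m → ℕ → Form Prop
  F {m} φs ψs i = ⋁ (map (λ de → signedConj φs ψs (proj₁ de) (proj₂ de)) (pairsF m i))

  upTo' : ℕ → List ℕ
  upTo' zero    = 0 ∷ []
  upTo' (suc m) = upTo' m ++ (suc m ∷ [])

  Seg : ∀ {m} → Vec (Form Prop) m → Vec (Form Prop) m → Form Prop
  Seg {m} φs ψs = K (⋁ (map (F φs ψs) (upTo' m)))

  data BaseAx : Form Prop → Set where
    CL   : ∀ {φ} → Tautology φ → BaseAx φ
    S5-K : ∀ {φ ψ} → BaseAx (K (φ ⇒ ψ) ⇒ (K φ ⇒ K ψ))
    S5-T : ∀ {φ} → BaseAx (K φ ⇒ φ)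
    S5-4 : ∀ {φ} → BaseAx (K φ ⇒ K (K φ))
    S5-5 : ∀ {φ} → BaseAx (¬' K φ ⇒ K (¬' K φ))
    N    : BaseAx (B ⊤')
    Ap   : ∀ {φ} → BaseAx (B φ ⇒ K (B φ))
    An   : ∀ {φ} → BaseAx (¬' B φ ⇒ K (¬' B φ))

  data BFKBMAx : Form Prop → Set where
    BF  : BFKBMAx (¬' B ⊥')
    KBM : ∀ {φ ψ} → BFKBMAx (K (φ ⇒ ψ) ⇒ (B φ ⇒ B ψ))

  data EqAx : Form Prop → Set where
    D     : ∀ {φ} → EqAx (B φ ⇒ Bˇ φ)
    SC    : ∀ {φ ψ} → EqAx ((Bˇ φ ∧' Kˇ (¬' φ ∧' ψ)) ⇒ B (φ ∨' ψ))
    Scott : ∀ {n} (φs ψs : Vec (Form Prop) (suc n)) →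
            EqAx ((Seg φs ψs ∧' B (head φs) ∧' ⋀ (map Bˇ (toList (tail φs))))
                  ⇒ ⋁ (map B (toList ψs)))

  KB= : Form Prop → Set
  KB= φ = BaseAx φ ⊎ BFKBMAx φ ⊎ EqAx φ

  KB=⁻ : Form Prop → Set
  KB=⁻ φ = BaseAx φ ⊎ EqAx φ

  data _⊢_ (Ax : Form Prop → Set) : Form Prop → Set where
    ax : ∀ {φ} → Ax φ → Ax ⊢ φ
    mp : ∀ {φ ψ} → Ax ⊢ (φ ⇒ ψ) → Ax ⊢ φ → Ax ⊢ ψ
    mn : ∀ {φ} → Ax ⊢ φ → Ax ⊢ K φ

  infix 4 _⊢_

-- Every axiom of KB= is a theorem of KB=⁻, so the two calculi prove the same
-- formulas. (KBM) is the case m = 1 of (Scott): for a single pair, the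
-- Segerberg formula (φ 𝕀 ψ) is K of a Boolean combination that is implied by
-- φ → ψ, so K (φ → ψ) yields it. (BF) then follows from (D), (N) and (KBM):
-- B ⊥ gives ¬ B ⊤ by (D), whereas (N) and (KBM) give B ¬⊥.
module Submission where

open import Defs
open import Function.Bundles using (_⇔_; mk⇔)
open import Data.Bool using (true; false)
open import Data.Sum using (inj₁; inj₂)
open import Data.Vec using ([]; _∷_)
open import Data.List using (map)
open import Relation.Binary.PropositionalEquality using (refl)
open import Function.Base using (_∘_)

module _ {Prop : Set} where

  private
    Fm = Form Prop

  ⊢-bind : ∀ {Ax Ax′ : Fm → Set} {φ : Fm} →
           (∀ {χ} → Ax χ → Ax′ ⊢ χ) → Ax ⊢ φ → Ax′ ⊢ φ
  ⊢-bind derive (ax a)   = derive a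
  ⊢-bind derive (mp p q) = mp (⊢-bind derive p) (⊢-bind derive q)
  ⊢-bind derive (mn p)   = mn (⊢-bind derive p)

  chain-through-conjunction : (a x y z : Fm) →
    Tautology ((a ⇒ x) ⇒ (((x ∧' y) ∧' ⊤') ⇒ z) ⇒ a ⇒ y ⇒ z)
  chain-through-conjunction a x y z v
    with evalB v a | evalB v x | evalB v y | evalB v z
  ... | true  | true  | true  | true  = refl
  ... | true  | true  | true  | false = refl
  ... | true  | true  | false | _     = refl
  ... | true  | false | _     | _     = refl
  ... | false | true  | true  | true  = refl
  ... | false | true  | true  | false = refl
  ... | false | true  | false | _     = refl
  ... | false | false | _     | _     = refl

  contraposition : (x y : Fm) → Tautology ((x ⇒ ¬' y) ⇒ y ⇒ ¬' x)
  contraposition x y v with evalB v x | evalB v y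
  ... | true  | true  = refl
  ... | true  | false = refl
  ... | false | true  = refl
  ... | false | false = refl

  -- Seg (φ ∷ []) (ψ ∷ []) is K (segMatrix₁ φ ψ).
  segMatrix₁ : Fm → Fm → Fm
  segMatrix₁ φ ψ = ⋁ (map (F (φ ∷ []) (ψ ∷ [])) (upTo' {Prop} 1))

  implication⇒segMatrix₁ : (φ ψ : Fm) → Tautology ((φ ⇒ ψ) ⇒ segMatrix₁ φ ψ)
  implication⇒segMatrix₁ φ ψ v with evalB v φ | evalB v ψ
  ... | true  | true  = refl
  ... | true  | false = refl
  ... | false | true  = refl
  ... | false | false = refl

  module _ {Ax : Fm → Set} (⊢-taut : ∀ {χ} → Tautology χ → Ax ⊢ χ) where

    mp-taut₂ : ∀ {a b c : Fm} → Tautology (a ⇒ b ⇒ c) → Ax ⊢ a → Ax ⊢ b → Ax ⊢ c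
    mp-taut₂ t p q = mp (mp (⊢-taut t) p) q

  KB=⁻⊢CL : ∀ {χ : Fm} → Tautology χ → KB=⁻ ⊢ χ
  KB=⁻⊢CL t = ax (inj₁ (CL t))

  KB=⁻⊢KBM : ∀ {φ ψ : Fm} → KB=⁻ ⊢ (K (φ ⇒ ψ) ⇒ (B φ ⇒ B ψ))
  KB=⁻⊢KBM {φ} {ψ} =
    mp-taut₂ KB=⁻⊢CL
      (chain-through-conjunction (K (φ ⇒ ψ)) (K (segMatrix₁ φ ψ)) (B φ) (B ψ))
      (mp (ax (inj₁ S5-K)) (mn (KB=⁻⊢CL (implication⇒segMatrix₁ φ ψ))))
      (ax (inj₂ (Scott (φ ∷ []) (ψ ∷ []))))

  KB=⁻⊢BF : KB=⁻ ⊢ ¬' B (⊥' {Prop})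
  KB=⁻⊢BF =
    mp-taut₂ KB=⁻⊢CL (contraposition (B ⊥') (B (¬' ⊥')))
      (ax (inj₂ D))
      (mp (mp KB=⁻⊢KBM (mn (KB=⁻⊢CL (λ _ → refl)))) (ax (inj₁ N)))

  KB=⁻⊢KB=-axiom : ∀ {χ : Fm} → KB= χ → KB=⁻ ⊢ χ
  KB=⁻⊢KB=-axiom (inj₁ a)          = ax (inj₁ a)
  KB=⁻⊢KB=-axiom (inj₂ (inj₁ BF))  = KB=⁻⊢BF
  KB=⁻⊢KB=-axiom (inj₂ (inj₁ KBM)) = KB=⁻⊢KBM
  KB=⁻⊢KB=-axiom (inj₂ (inj₂ a))   = ax (inj₂ a)

  KB=⁻⊆KB= : ∀ {χ : Fm} → KB=⁻ χ → KB= χ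
  KB=⁻⊆KB= (inj₁ a) = inj₁ a
  KB=⁻⊆KB= (inj₂ a) = inj₂ (inj₂ a)

mainTheorem10 : (Prop : Set) (φ : Form Prop) → (KB=⁻ ⊢ φ) ⇔ (KB= ⊢ φ)
mainTheorem10 Prop φ = mk⇔ (⊢-bind (ax ∘ KB=⁻⊆KB=)) (⊢-bind KB=⁻⊢KB=-axiom)
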